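{- Let $n, m, d$ be positive integers with $m < n$. Then $P(n,d) \ge P(n,m,d)\cdot P(n-m,d)$.
   Context: For permutations $\sigma,\pi$ of $[1\ldots n]=\{1,\dots,n\}$ (written as strings $\sigma(1)\sigma(2)\cdots\sigma(n)$), the Kendall-$\tau$ distance $d(\sigma,\pi)$ is the minimum number of adjacent transpositions needed to transform $\sigma$ into $\pi$ (equivalently, the number of pairs of symbols appearing in different relative order in $\sigma$ and $\pi$). An $(n,d)$-PA is a set of permutations of $[1\ldots n]$ whose pairwise Kendall-$\tau$ distances are all at least $d$, and $P(n,d)$ is the maximum cardinality of an $(n,d)$-PA. For $m<n$, $S_{n,m}$ is the set of permutations of $[1\ldots n]$ in which the symbols $1,2,\dots,n-m$ appear in increasing order (left to right). An $(n,m,d)$-array is a subset of $S_{n,m}$ whose pairwise Kendall-$\tau$ distances are all at least $d$, and $P(n,m,d)$ is the maximum cardinality of an $(n,m,d)$-array. -}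

module Defs where

open import Data.Nat using (ℕ; zero; suc; _+_; _≤_; _<_; _<ᵇ_)
open import Data.Bool using (Bool; true; false; _∧_; _xor_; if_then_else_)
open import Data.Fin using (Fin; toℕ)
open import Data.Fin.Permutation using (Permutation′; _⟨$⟩ˡ_)
open import Data.Nat.ListAction using (sum)
open import Data.List using (List; []; _∷_; length; map; concatMap; allFin)
open import Data.List.Relation.Unary.All using (All)
open import Data.List.Relation.Unary.AllPairs using (AllPairs)
open import Data.Product using (Σ; _×_)
open import Relation.Binary.PropositionalEquality using (_≡_)

-- Symbols are 0-indexed: the symbols 1..n of the paper are Fin n = {0..n-1}.
-- A permutation σ : Permutation′ n maps positions to symbols (σ ⟨$⟩ʳ i is the
-- symbol at position i), so σ ⟨$⟩ˡ a is the position of symbol a.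
pos : ∀ {n} → Permutation′ n → Fin n → ℕ
pos σ a = toℕ (σ ⟨$⟩ˡ a)

differ : ∀ {n} → Permutation′ n → Permutation′ n → Fin n → Fin n → Bool
differ σ π a b = (pos σ a <ᵇ pos σ b) xor (pos π a <ᵇ pos π b)

kendall : ∀ {n} → Permutation′ n → Permutation′ n → ℕ
kendall {n} σ π =
  sum (concatMap (λ a → map (λ b → if (toℕ a <ᵇ toℕ b) ∧ differ σ π a b then 1 else 0)
                            (allFin n))
                 (allFin n))

-- An (n,d)-PA, given as a list of permutations with pairwise distance ≥ d
-- (for d ≥ 1 this forces the entries to be distinct, so length = cardinality).
IsPA : (n d : ℕ) → List (Permutation′ n) → Set
IsPA n d C = AllPairs (λ σ π → d ≤ kendall σ π) C

-- S_{n,m}: the symbols 1..n-m (here 0..n-m-1) appear in increasing order.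
InS : (n m : ℕ) → Permutation′ n → Set
InS n m σ = ∀ (a b : Fin n) → toℕ a < toℕ b → toℕ b + m < n → pos σ a < pos σ b

IsArray : (n m d : ℕ) → List (Permutation′ n) → Set
IsArray n m d C = All (InS n m) C × IsPA n d C

IsP : (n d k : ℕ) → Set
IsP n d k = Σ (List (Permutation′ n)) (λ C → IsPA n d C × length C ≡ k)
          × (∀ C → IsPA n d C → length C ≤ k)

IsPnm : (n m d k : ℕ) → Set
IsPnm n m d k = Σ (List (Permutation′ n)) (λ C → IsArray n m d C × length C ≡ k)
              × (∀ C → IsArray n m d C → length C ≤ k)

-- Write k = n − m and call the symbols below k small.  Relabel the small
-- symbols of each σ of an optimal (n,m,d)-array through each τ of an optimal
-- (k,d)-PA; the resulting |C|·|D| permutations form an (n,d)-PA.  For a fixed σ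
-- the small symbols of the relabellings are ordered as by τ, so their distance
-- is at least d(τ, τ′).  For different σ, σ′ it is at least d(σ, σ′): pairs of
-- large symbols keep their positions, pairs of small symbols are in order in σ
-- and σ′, and for a large symbol b the small symbols before b form an initial
-- segment in σ, so the mixed pairs at b ordered differently by σ and σ′ number
-- exactly the difference of two counts.  Relabelling preserves these counts,
-- and two sets of given sizes differ in at least that many elements.
module Submission where

open import Defs
open import Data.Bool using (Bool; true; false; T; T?; not; _∧_; _xor_; if_then_else_)
open import Data.Bool.Properties using (T-≡; T-∧; xor-same; xor-comm; xor-identityʳ; ∧-zeroʳ)
open import Data.Fin using (Fin; zero; suc; toℕ; inject≤; fromℕ<)
open import Data.Fin.Properties using (toℕ-injective; toℕ-inject≤; toℕ-fromℕ<; toℕ<n)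
open import Data.Fin.Permutation
  using (Permutation′; permutation; _∘ₚ_; _⟨$⟩ʳ_; _⟨$⟩ˡ_; inverseˡ; inverseʳ)
open import Data.List using (List; []; _∷_; _++_; length; map; concatMap; allFin; tabulate; cartesianProductWith)
open import Data.List.Properties using (length-++; length-map; map-tabulate)
open import Data.List.Relation.Unary.All using (All; []; _∷_)
import Data.List.Relation.Unary.All as All
import Data.List.Relation.Unary.All.Properties as All
open import Data.List.Relation.Unary.AllPairs as AllPairs using ([]; _∷_)
import Data.List.Relation.Unary.AllPairs.Properties as AllPairs
import Data.Nat.ListAction as List
open import Data.Nat.ListAction.Properties using (sum-++)
open import Data.Nat
open import Data.Nat.Properties
open import Algebra.Properties.CommutativeMonoid.Sum +-0-commutativeMonoid
  using (sum; sum-syntax; sum-cong-≗; ∑-comm; ∑-distrib-+; ∑-permute)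
open import Data.Product using (_,_; proj₁; proj₂)
open import Data.Sum using (inj₁; inj₂)
open import Function using (_∘_; Equivalence)
open import Relation.Nullary using (¬_; Dec; yes; no; contradiction)
open import Relation.Nullary.Reflects using (ofʸ; ofⁿ; det; fromEquivalence)
open import Relation.Binary using (tri<; tri≈; tri>)
open import Relation.Binary.PropositionalEquality

private
  variable
    A B C : Set

<ᵇ-true : ∀ {x y} → x < y → (x <ᵇ y) ≡ true
<ᵇ-true {x} {y} x<y = det (<ᵇ-reflects-< x y) (ofʸ x<y)

<ᵇ-false : ∀ {x y} → ¬ x < y → (x <ᵇ y) ≡ false
<ᵇ-false {x} {y} x≮y = det (<ᵇ-reflects-< x y) (ofⁿ x≮y)

<ᵇ-cong-⇔ : ∀ {x y u v} → (x < y → u < v) → (u < v → x < y) → (x <ᵇ y) ≡ (u <ᵇ v)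
<ᵇ-cong-⇔ {x} {y} {u} {v} to from =
  det (<ᵇ-reflects-< x y) (fromEquivalence (from ∘ <ᵇ⇒< u v) (<⇒<ᵇ ∘ to))

∣m-n∣≤o : ∀ {m n o} → m ≤ n + o → n ≤ m + o → ∣ m - n ∣ ≤ o
∣m-n∣≤o {m} {n} m≤n+o n≤m+o with ∣m-n∣≡[m∸n]∨[n∸m] m n
... | inj₁ eq = subst (_≤ _) (sym eq) (m≤n+o⇒m∸n≤o m n m≤n+o)
... | inj₂ eq = subst (_≤ _) (sym eq) (m≤n+o⇒m∸n≤o n m n≤m+o)

length-cartesianProductWith : (f : A → B → C) (xs : List A) (ys : List B) →
  length (cartesianProductWith f xs ys) ≡ length xs * length ys
length-cartesianProductWith f [] ys = refl
length-cartesianProductWith f (x ∷ xs) ys = begin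
  length (map (f x) ys ++ cartesianProductWith f xs ys)          ≡⟨ length-++ (map (f x) ys) ⟩
  length (map (f x) ys) + length (cartesianProductWith f xs ys)  ≡⟨ cong₂ _+_ (length-map (f x) ys)
                                                                      (length-cartesianProductWith f xs ys) ⟩
  length ys + length xs * length ys                              ∎
  where open ≡-Reasoning

sum-mono-≤ : ∀ {n} {f g : Fin n → ℕ} → (∀ i → f i ≤ g i) → sum f ≤ sum g
sum-mono-≤ {zero} f≤g = z≤n
sum-mono-≤ {suc n} f≤g = +-mono-≤ (f≤g zero) (sum-mono-≤ (f≤g ∘ suc))

sum-inject≤-≤ : ∀ {k n} (k≤n : k ≤ n) (f : Fin n → ℕ) → sum (λ i → f (inject≤ i k≤n)) ≤ sum f
sum-inject≤-≤ {zero} k≤n f = z≤n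
sum-inject≤-≤ {suc k} {suc n} (s≤s k≤n) f = +-monoʳ-≤ (f zero) (sum-inject≤-≤ k≤n (f ∘ suc))

sum-tabulate : ∀ {n} (f : Fin n → ℕ) → List.sum (tabulate f) ≡ sum f
sum-tabulate {zero} f = refl
sum-tabulate {suc n} f = cong (f zero +_) (sum-tabulate (f ∘ suc))

sum-map-allFin : ∀ {n} (f : Fin n → ℕ) → List.sum (map f (allFin n)) ≡ sum f
sum-map-allFin f = trans (cong List.sum (map-tabulate (λ i → i) f)) (sum-tabulate f)

sum-concatMap : (g : A → List ℕ) (xs : List A) →
  List.sum (concatMap g xs) ≡ List.sum (map (List.sum ∘ g) xs)
sum-concatMap g [] = refl
sum-concatMap g (x ∷ xs) = trans (sum-++ (g x) (concatMap g xs)) (cong (List.sum (g x) +_) (sum-concatMap g xs))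

-- Spelled as in the definition of kendall, which therefore unfolds to a sum of 𝟙s.
𝟙 : Bool → ℕ
𝟙 b = if b then 1 else 0

inverted : ∀ {n} → Permutation′ n → Permutation′ n → Fin n → Fin n → Bool
inverted σ π a b = (toℕ a <ᵇ toℕ b) ∧ differ σ π a b

kendall-∑ : ∀ {n} (σ π : Permutation′ n) →
  kendall σ π ≡ ∑[ a < n ] ∑[ b < n ] 𝟙 (inverted σ π a b)
kendall-∑ {n} σ π = begin
  kendall σ π                                                   ≡⟨ sum-concatMap row (allFin n) ⟩
  List.sum (map (List.sum ∘ row) (allFin n))                    ≡⟨ sum-map-allFin (List.sum ∘ row) ⟩
  ∑[ a < n ] List.sum (row a)                                    ≡⟨ sum-cong-≗ (λ a → sum-map-allFin (𝟙 ∘ inverted σ π a)) ⟩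
  ∑[ a < n ] ∑[ b < n ] 𝟙 (inverted σ π a b)                     ∎
  where
  open ≡-Reasoning
  row : Fin n → List ℕ
  row a = map (λ b → 𝟙 (inverted σ π a b)) (allFin n)

count : ∀ {n} → (Fin n → Bool) → ℕ
count f = sum (λ i → 𝟙 (f i))

count-≤-count-xor : ∀ {n} (f g : Fin n → Bool) → count f ≤ count g + count (λ i → f i xor g i)
count-≤-count-xor f g = begin
  count f                                            ≤⟨ sum-mono-≤ (λ i → pointwise (f i) (g i)) ⟩
  ∑[ i < _ ] (𝟙 (g i) + 𝟙 (f i xor g i))             ≡⟨ ∑-distrib-+ (𝟙 ∘ g) (λ i → 𝟙 (f i xor g i)) ⟩
  count g + count (λ i → f i xor g i)               ∎
  where
  open ≤-Reasoning
  pointwise : ∀ a b → 𝟙 a ≤ 𝟙 b + 𝟙 (a xor b)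
  pointwise false b = z≤n
  pointwise true false = ≤-refl
  pointwise true true = ≤-refl

count-xor-comm : ∀ {n} (f g : Fin n → Bool) → count (λ i → f i xor g i) ≡ count (λ i → g i xor f i)
count-xor-comm f g = sum-cong-≗ (λ i → cong 𝟙 (xor-comm (f i) (g i)))

∣count-count∣≤count-xor : ∀ {n} (f g : Fin n → Bool) → ∣ count f - count g ∣ ≤ count (λ i → f i xor g i)
∣count-count∣≤count-xor f g = ∣m-n∣≤o (count-≤-count-xor f g)
  (subst (λ c → count g ≤ count f + c) (count-xor-comm g f) (count-≤-count-xor g f))

DownClosed : ∀ {n} → (Fin n → Bool) → Set
DownClosed f = ∀ {i j} → toℕ j < toℕ i → T (f i) → T (f j)

downClosed-⊥ : ∀ {n} {f : Fin (suc n) → Bool} → DownClosed f → ¬ T (f zero) → ∀ i → ¬ T (f i)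
downClosed-⊥ f↓ ¬f₀ zero = ¬f₀
downClosed-⊥ f↓ ¬f₀ (suc i) = ¬f₀ ∘ f↓ z<s

¬T⇒≡false : ∀ {b} → ¬ T b → b ≡ false
¬T⇒≡false {false} _ = refl
¬T⇒≡false {true} ¬t = contradiction _ ¬t

count-⊥ : ∀ {n} {f : Fin n → Bool} → (∀ i → ¬ T (f i)) → count f ≡ 0
count-⊥ {zero} ¬f = refl
count-⊥ {suc n} {f} ¬f rewrite ¬T⇒≡false (¬f zero) = count-⊥ (¬f ∘ suc)

count-xor-⊥ : ∀ {n} (f : Fin n → Bool) {g : Fin n → Bool} → (∀ i → ¬ T (g i)) →
  count (λ i → f i xor g i) ≡ ∣ count f - count g ∣
count-xor-⊥ f {g} ¬g = begin
  count (λ i → f i xor g i)  ≡⟨ sum-cong-≗ (λ i → cong (λ b → 𝟙 (f i xor b)) (¬T⇒≡false (¬g i))) ⟩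
  count (λ i → f i xor false) ≡⟨ sum-cong-≗ (λ i → cong 𝟙 (xor-identityʳ (f i))) ⟩
  count f                     ≡⟨ ∣-∣-identityʳ (count f) ⟨
  ∣ count f - 0 ∣             ≡⟨ cong (∣ count f -_∣) (count-⊥ ¬g) ⟨
  ∣ count f - count g ∣       ∎
  where open ≡-Reasoning

count-xor≤∣count-count∣ : ∀ {n} {f g : Fin n → Bool} → DownClosed f → DownClosed g →
  count (λ i → f i xor g i) ≤ ∣ count f - count g ∣
count-xor≤∣count-count∣ {zero} f↓ g↓ = z≤n
count-xor≤∣count-count∣ {suc n} {f} {g} f↓ g↓ with T? (f zero) | T? (g zero)
... | _ | no ¬g₀ = ≤-reflexive (count-xor-⊥ f (downClosed-⊥ g↓ ¬g₀))
... | no ¬f₀ | yes _ = ≤-reflexive (begin-equality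
  count (λ i → f i xor g i)  ≡⟨ count-xor-comm f g ⟩
  count (λ i → g i xor f i)  ≡⟨ count-xor-⊥ g (downClosed-⊥ f↓ ¬f₀) ⟩
  ∣ count g - count f ∣      ≡⟨ ∣-∣-comm (count g) (count f) ⟩
  ∣ count f - count g ∣      ∎)
  where open ≤-Reasoning
... | yes f₀ | yes g₀ = begin
  count (λ i → f i xor g i)            ≡⟨ cong₂ (λ a b → 𝟙 (a xor b) + count (λ i → f (suc i) xor g (suc i))) (T⇒≡true f₀) (T⇒≡true g₀) ⟩
  count (λ i → f (suc i) xor g (suc i)) ≤⟨ count-xor≤∣count-count∣ (f↓ ∘ s<s) (g↓ ∘ s<s) ⟩
  ∣ count (f ∘ suc) - count (g ∘ suc) ∣ ≡⟨ cong₂ (λ a b → ∣ 𝟙 a + count (f ∘ suc) - 𝟙 b + count (g ∘ suc) ∣) (T⇒≡true f₀) (T⇒≡true g₀) ⟨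
  ∣ count f - count g ∣                 ∎
  where
  open ≤-Reasoning
  T⇒≡true : ∀ {b} → T b → b ≡ true
  T⇒≡true = Equivalence.to T-≡

kendall-inject≤-≤ : ∀ {k n} (k≤n : k ≤ n) (τ τ' : Permutation′ k) (α α' : Permutation′ n) →
  (∀ a b → differ α α' (inject≤ a k≤n) (inject≤ b k≤n) ≡ differ τ τ' a b) →
  kendall τ τ' ≤ kendall α α'
kendall-inject≤-≤ {k} {n} k≤n τ τ' α α' same = begin
  kendall τ τ'                                          ≡⟨ kendall-∑ τ τ' ⟩
  ∑[ a < k ] ∑[ b < k ] 𝟙 (inverted τ τ' a b)            ≡⟨ sum-cong-≗ (λ a → sum-cong-≗ (λ b → cong 𝟙 (inverted-inject≤ a b))) ⟨
  ∑[ a < k ] ∑[ b < k ] 𝟙 (inverted α α' (ι a) (ι b))    ≤⟨ sum-mono-≤ (λ a → sum-inject≤-≤ k≤n (𝟙 ∘ inverted α α' (ι a))) ⟩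
  ∑[ a < k ] ∑[ b < n ] 𝟙 (inverted α α' (ι a) b)        ≤⟨ sum-inject≤-≤ k≤n (λ a → ∑[ b < n ] 𝟙 (inverted α α' a b)) ⟩
  ∑[ a < n ] ∑[ b < n ] 𝟙 (inverted α α' a b)            ≡⟨ kendall-∑ α α' ⟨
  kendall α α'                                          ∎
  where
  open ≤-Reasoning
  ι : Fin k → Fin n
  ι t = inject≤ t k≤n
  inverted-inject≤ : ∀ a b → inverted α α' (ι a) (ι b) ≡ inverted τ τ' a b
  inverted-inject≤ a b = cong₂ _∧_ (cong₂ _<ᵇ_ (toℕ-inject≤ a k≤n) (toℕ-inject≤ b k≤n)) (same a b)

SmallSorted : ∀ {n} → ℕ → Permutation′ n → Set
SmallSorted k σ = ∀ {a b} → toℕ a < toℕ b → toℕ b < k → pos σ a < pos σ b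

sorted-<ᵇ : ∀ {k n} (σ : Permutation′ n) → SmallSorted k σ → ∀ {u v} → toℕ u < k → toℕ v < k →
  (pos σ u <ᵇ pos σ v) ≡ (toℕ u <ᵇ toℕ v)
sorted-<ᵇ σ σ↑ {u} {v} u<k v<k = <ᵇ-cong-⇔ reflect (λ u<v → σ↑ u<v v<k)
  where
  reflect : pos σ u < pos σ v → toℕ u < toℕ v
  reflect σu<σv with <-cmp (toℕ u) (toℕ v)
  ... | tri< u<v _ _ = u<v
  ... | tri≈ _ u≡v _ = contradiction (subst (λ w → pos σ u < pos σ w) (sym (toℕ-injective u≡v)) σu<σv) (<-irrefl refl)
  ... | tri> _ _ v<u = contradiction (σ↑ v<u u<k) (<-asym σu<σv)

inverted-sorted : ∀ {k n} (σ σ' : Permutation′ n) → SmallSorted k σ → SmallSorted k σ' →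
  ∀ {b} → toℕ b < k → ∀ a → inverted σ σ' a b ≡ false
inverted-sorted σ σ' σ↑ σ'↑ {b} b<k a with toℕ a <? toℕ b
... | yes a<b rewrite sorted-<ᵇ σ σ↑ (<-trans a<b b<k) b<k | sorted-<ᵇ σ' σ'↑ (<-trans a<b b<k) b<k
                    | xor-same (toℕ a <ᵇ toℕ b) = ∧-zeroʳ _
... | no a≮b rewrite <ᵇ-false a≮b = refl

module Relabel {k n : ℕ} (k≤n : k ≤ n) where

  small : Fin n → Bool
  small s = toℕ s <ᵇ k

  embed : Fin k → Fin n
  embed t = inject≤ t k≤n

  toℕ-embed : ∀ t → toℕ (embed t) ≡ toℕ t
  toℕ-embed t = toℕ-inject≤ t k≤n

  embed-small : ∀ t → toℕ (embed t) < k
  embed-small t = subst (_< k) (sym (toℕ-embed t)) (toℕ<n t)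

  embed-fromℕ< : ∀ {s} (s<k : toℕ s < k) → embed (fromℕ< s<k) ≡ s
  embed-fromℕ< s<k = toℕ-injective (trans (toℕ-embed _) (toℕ-fromℕ< s<k))

  extendFun : (Fin k → Fin k) → Fin n → Fin n
  extendFun g s with toℕ s <? k
  ... | yes s<k = embed (g (fromℕ< s<k))
  ... | no _ = s

  extendFun-embed : ∀ g t → extendFun g (embed t) ≡ embed (g t)
  extendFun-embed g t with toℕ (embed t) <? k
  ... | yes t<k = cong (embed ∘ g) (toℕ-injective (trans (toℕ-fromℕ< t<k) (toℕ-embed t)))
  ... | no t≮k = contradiction (embed-small t) t≮k

  extendFun-large : ∀ g {s} → ¬ toℕ s < k → extendFun g s ≡ s
  extendFun-large g {s} s≮k with toℕ s <? k
  ... | yes s<k = contradiction s<k s≮k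
  ... | no _ = refl

  extendFun-inverse : ∀ {g h} → (∀ t → g (h t) ≡ t) → ∀ s → extendFun g (extendFun h s) ≡ s
  extendFun-inverse {g} {h} gh s with toℕ s <? k
  ... | yes s<k = trans (extendFun-embed g _) (trans (cong embed (gh _)) (embed-fromℕ< s<k))
  ... | no s≮k = extendFun-large g s≮k

  small-extendFun : ∀ g s → small (extendFun g s) ≡ small s
  small-extendFun g s with toℕ s <? k
  ... | yes s<k = trans (<ᵇ-true (embed-small _)) (sym (<ᵇ-true s<k))
  ... | no _ = refl

  extend : Permutation′ k → Permutation′ n
  extend τ = permutation (extendFun (τ ⟨$⟩ʳ_)) (extendFun (τ ⟨$⟩ˡ_))
    (extendFun-inverse (λ _ → inverseʳ τ)) (extendFun-inverse (λ _ → inverseˡ τ))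

  relabel : Permutation′ n → Permutation′ k → Permutation′ n
  relabel σ τ = σ ∘ₚ extend τ

  pos-relabel-large : ∀ σ τ {s} → ¬ toℕ s < k → pos (relabel σ τ) s ≡ pos σ s
  pos-relabel-large σ τ s≮k = cong (toℕ ∘ (σ ⟨$⟩ˡ_)) (extendFun-large (τ ⟨$⟩ˡ_) s≮k)

  before-relabel-embed : ∀ σ → SmallSorted k σ → ∀ τ a b →
    (pos (relabel σ τ) (embed a) <ᵇ pos (relabel σ τ) (embed b)) ≡ (pos τ a <ᵇ pos τ b)
  before-relabel-embed σ σ↑ τ a b = begin
    pos (relabel σ τ) (embed a) <ᵇ pos (relabel σ τ) (embed b)  ≡⟨ cong₂ _<ᵇ_ (pos-embed a) (pos-embed b) ⟩
    pos σ (embed (τ ⟨$⟩ˡ a)) <ᵇ pos σ (embed (τ ⟨$⟩ˡ b))        ≡⟨ sorted-<ᵇ σ σ↑ (embed-small (τ ⟨$⟩ˡ a)) (embed-small (τ ⟨$⟩ˡ b)) ⟩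
    toℕ (embed (τ ⟨$⟩ˡ a)) <ᵇ toℕ (embed (τ ⟨$⟩ˡ b))            ≡⟨ cong₂ _<ᵇ_ (toℕ-embed (τ ⟨$⟩ˡ a)) (toℕ-embed (τ ⟨$⟩ˡ b)) ⟩
    pos τ a <ᵇ pos τ b                                          ∎
    where
    open ≡-Reasoning
    pos-embed : ∀ c → pos (relabel σ τ) (embed c) ≡ pos σ (embed (τ ⟨$⟩ˡ c))
    pos-embed c = cong (toℕ ∘ (σ ⟨$⟩ˡ_)) (extendFun-embed (τ ⟨$⟩ˡ_) c)

  kendall-labels≤kendall-relabel : ∀ σ → SmallSorted k σ → ∀ τ τ' → kendall τ τ' ≤ kendall (relabel σ τ) (relabel σ τ')
  kendall-labels≤kendall-relabel σ σ↑ τ τ' = kendall-inject≤-≤ k≤n τ τ' (relabel σ τ) (relabel σ τ')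
    (λ a b → cong₂ _xor_ (before-relabel-embed σ σ↑ τ a b) (before-relabel-embed σ σ↑ τ' a b))

  small-true : ∀ {s} → toℕ s < k → small s ≡ true
  small-true = <ᵇ-true

  smallBefore : Permutation′ n → Fin n → Fin n → Bool
  smallBefore α b a = small a ∧ (pos α a <ᵇ pos α b)

  largeInverted : Permutation′ n → Permutation′ n → Fin n → Fin n → Bool
  largeInverted α β b a = not (small a) ∧ inverted α β a b

  inverted-split : ∀ α β {b} → ¬ toℕ b < k → ∀ a →
    𝟙 (inverted α β a b) ≡ 𝟙 (smallBefore α b a xor smallBefore β b a) + 𝟙 (largeInverted α β b a)
  inverted-split α β {b} b≮k a with toℕ a <? k
  ... | yes a<k rewrite small-true a<k | <ᵇ-true (<-≤-trans a<k (≮⇒≥ b≮k)) = sym (+-identityʳ _)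
  ... | no a≮k rewrite <ᵇ-false a≮k = refl

  smallBefore-downClosed : ∀ σ → SmallSorted k σ → ∀ b → DownClosed (smallBefore σ b)
  smallBefore-downClosed σ σ↑ b {i} {j} j<i i-smallBefore =
    Equivalence.from T-∧ (<⇒<ᵇ (<-trans j<i i<k) , <⇒<ᵇ (<-trans (σ↑ j<i i<k) i-before))
    where
    i<k : toℕ i < k
    i<k = <ᵇ⇒< _ _ (proj₁ (Equivalence.to T-∧ i-smallBefore))
    i-before : pos σ i < pos σ b
    i-before = <ᵇ⇒< _ _ (proj₂ (Equivalence.to T-∧ i-smallBefore))

  count-smallBefore-relabel : ∀ σ τ {b} → ¬ toℕ b < k →
    count (smallBefore (relabel σ τ) b) ≡ count (smallBefore σ b)
  count-smallBefore-relabel σ τ {b} b≮k = begin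
    count (smallBefore (relabel σ τ) b)                          ≡⟨ ∑-permute _ (extend τ) ⟩
    ∑[ s < n ] 𝟙 (smallBefore (relabel σ τ) b (extend τ ⟨$⟩ʳ s))  ≡⟨ sum-cong-≗ (cong 𝟙 ∘ smallBefore-extend) ⟩
    count (smallBefore σ b)                                      ∎
    where
    open ≡-Reasoning
    smallBefore-extend : ∀ s → smallBefore (relabel σ τ) b (extend τ ⟨$⟩ʳ s) ≡ smallBefore σ b s
    smallBefore-extend s = cong₂ _∧_ (small-extendFun (τ ⟨$⟩ʳ_) s)
      (cong₂ _<ᵇ_ (cong (toℕ ∘ (σ ⟨$⟩ˡ_)) (inverseˡ (extend τ))) (pos-relabel-large σ τ b≮k))

  largeInverted-relabel : ∀ σ σ' τ τ' {b} → ¬ toℕ b < k → ∀ a →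
    largeInverted (relabel σ τ) (relabel σ' τ') b a ≡ largeInverted σ σ' b a
  largeInverted-relabel σ σ' τ τ' {b} b≮k a = by-size (toℕ a <? k)
    -- not a 'with': that would also abstract the test toℕ a <? k inside extendFun
    where
    α α' : Permutation′ n
    α = relabel σ τ
    α' = relabel σ' τ'
    by-size : Dec (toℕ a < k) → largeInverted α α' b a ≡ largeInverted σ σ' b a
    by-size (yes a<k) = trans (cong (λ x → not x ∧ inverted α α' a b) (small-true a<k))
                              (sym (cong (λ x → not x ∧ inverted σ σ' a b) (small-true a<k)))
    by-size (no a≮k) = cong (λ d → not (small a) ∧ ((toℕ a <ᵇ toℕ b) ∧ d))
      (cong₂ _xor_ (cong₂ _<ᵇ_ (pos-relabel-large σ τ a≮k) (pos-relabel-large σ τ b≮k))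
                   (cong₂ _<ᵇ_ (pos-relabel-large σ' τ' a≮k) (pos-relabel-large σ' τ' b≮k)))

  module _ (σ σ' : Permutation′ n) (σ↑ : SmallSorted k σ) (σ'↑ : SmallSorted k σ') (τ τ' : Permutation′ k) where

    private
      α α' : Permutation′ n
      α = relabel σ τ
      α' = relabel σ' τ'

    count-smallBefore-xor-≤ : ∀ {b} → ¬ toℕ b < k →
      count (λ a → smallBefore σ b a xor smallBefore σ' b a) ≤ count (λ a → smallBefore α b a xor smallBefore α' b a)
    count-smallBefore-xor-≤ {b} b≮k = begin
      count (λ a → smallBefore σ b a xor smallBefore σ' b a)
        ≤⟨ count-xor≤∣count-count∣ (smallBefore-downClosed σ σ↑ b) (smallBefore-downClosed σ' σ'↑ b) ⟩
      ∣ count (smallBefore σ b) - count (smallBefore σ' b) ∣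
        ≡⟨ cong₂ ∣_-_∣ (count-smallBefore-relabel σ τ b≮k) (count-smallBefore-relabel σ' τ' b≮k) ⟨
      ∣ count (smallBefore α b) - count (smallBefore α' b) ∣
        ≤⟨ ∣count-count∣≤count-xor (smallBefore α b) (smallBefore α' b) ⟩
      count (λ a → smallBefore α b a xor smallBefore α' b a)
        ∎
      where open ≤-Reasoning

    column-large-≤ : ∀ {b} → ¬ toℕ b < k → ∑[ a < n ] 𝟙 (inverted σ σ' a b) ≤ ∑[ a < n ] 𝟙 (inverted α α' a b)
    column-large-≤ {b} b≮k = begin
      ∑[ a < n ] 𝟙 (inverted σ σ' a b)
        ≡⟨ sum-cong-≗ (inverted-split σ σ' b≮k) ⟩
      ∑[ a < n ] (𝟙 (smallBefore σ b a xor smallBefore σ' b a) + 𝟙 (largeInverted σ σ' b a))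
        ≡⟨ ∑-distrib-+ (λ a → 𝟙 (smallBefore σ b a xor smallBefore σ' b a)) (𝟙 ∘ largeInverted σ σ' b) ⟩
      count (λ a → smallBefore σ b a xor smallBefore σ' b a) + count (largeInverted σ σ' b)
        ≤⟨ +-monoˡ-≤ _ (count-smallBefore-xor-≤ b≮k) ⟩
      count (λ a → smallBefore α b a xor smallBefore α' b a) + count (largeInverted σ σ' b)
        ≡⟨ cong (count (λ a → smallBefore α b a xor smallBefore α' b a) +_)
                (sum-cong-≗ (cong 𝟙 ∘ largeInverted-relabel σ σ' τ τ' b≮k)) ⟨
      count (λ a → smallBefore α b a xor smallBefore α' b a) + count (largeInverted α α' b)
        ≡⟨ ∑-distrib-+ (λ a → 𝟙 (smallBefore α b a xor smallBefore α' b a)) (𝟙 ∘ largeInverted α α' b) ⟨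
      ∑[ a < n ] (𝟙 (smallBefore α b a xor smallBefore α' b a) + 𝟙 (largeInverted α α' b a))
        ≡⟨ sum-cong-≗ (inverted-split α α' b≮k) ⟨
      ∑[ a < n ] 𝟙 (inverted α α' a b)
        ∎
      where open ≤-Reasoning

    column-≤ : ∀ b → ∑[ a < n ] 𝟙 (inverted σ σ' a b) ≤ ∑[ a < n ] 𝟙 (inverted α α' a b)
    column-≤ b = by-size (toℕ b <? k)
      where
      by-size : Dec (toℕ b < k) → ∑[ a < n ] 𝟙 (inverted σ σ' a b) ≤ ∑[ a < n ] 𝟙 (inverted α α' a b)
      by-size (yes b<k) = ≤-trans (≤-reflexive (count-⊥ (λ a → subst T (inverted-sorted σ σ' σ↑ σ'↑ b<k a)))) z≤n
      by-size (no b≮k) = column-large-≤ b≮k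

    kendall≤kendall-relabel : kendall σ σ' ≤ kendall α α'
    kendall≤kendall-relabel = begin
      kendall σ σ'                                  ≡⟨ kendall-∑ σ σ' ⟩
      ∑[ a < n ] ∑[ b < n ] 𝟙 (inverted σ σ' a b)    ≡⟨ ∑-comm (λ a b → 𝟙 (inverted σ σ' a b)) ⟩
      ∑[ b < n ] ∑[ a < n ] 𝟙 (inverted σ σ' a b)    ≤⟨ sum-mono-≤ column-≤ ⟩
      ∑[ b < n ] ∑[ a < n ] 𝟙 (inverted α α' a b)    ≡⟨ ∑-comm (λ a b → 𝟙 (inverted α α' a b)) ⟨
      ∑[ a < n ] ∑[ b < n ] 𝟙 (inverted α α' a b)    ≡⟨ kendall-∑ α α' ⟨
      kendall α α'                                  ∎
      where open ≤-Reasoning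

  relabel-isPA : ∀ {d C D} → All (SmallSorted k) C → IsPA n d C → IsPA k d D →
    IsPA n d (cartesianProductWith relabel C D)
  relabel-isPA [] [] _ = []
  relabel-isPA {d} {σ ∷ C} {D} (σ↑ ∷ C↑) (σ-far ∷ C-far) D-far =
    AllPairs.++⁺ (AllPairs.map⁺ (AllPairs.map (λ {τ} {τ'} d≤ → ≤-trans d≤ (kendall-labels≤kendall-relabel σ σ↑ τ τ')) D-far))
                 (relabel-isPA C↑ C-far D-far)
                 (All.map⁺ (All.tabulate (λ {τ} _ → far τ)))
    where
    far : ∀ τ → All (λ α → d ≤ kendall (relabel σ τ) α) (cartesianProductWith relabel C D)
    far τ = All.cartesianProductWith⁺ (setoid _) (setoid _) relabel C D
      (λ {σ'} {τ'} σ'∈C _ → ≤-trans (All.lookup σ-far σ'∈C) (kendall≤kendall-relabel σ σ' σ↑ (All.lookup C↑ σ'∈C) τ τ'))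

InS⇒SmallSorted : ∀ {n m} {σ : Permutation′ n} → m ≤ n → InS n m σ → SmallSorted (n ∸ m) σ
InS⇒SmallSorted m≤n σ∈S {a} {b} a<b b<n∸m = σ∈S a b a<b (m≤o∸n⇒m+n≤o (suc (toℕ b)) m≤n b<n∸m)

theorem6 : (n m d : ℕ) → 0 < n → 0 < m → 0 < d → m < n →
    (p q r : ℕ) → IsP n d p → IsPnm n m d q → IsP (n ∸ m) d r →
    q * r ≤ p
theorem6 n m d _ _ _ m<n p q r (_ , P-maximal) ((C , (C⊆S , C-far) , ∣C∣≡q) , _) ((D , D-far , ∣D∣≡r) , _) = begin
  q * r                                      ≡⟨ cong₂ _*_ ∣C∣≡q ∣D∣≡r ⟨
  length C * length D                        ≡⟨ length-cartesianProductWith relabel C D ⟨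
  length (cartesianProductWith relabel C D)  ≤⟨ P-maximal _ (relabel-isPA C-sorted C-far D-far) ⟩
  p                                          ∎
  where
  open ≤-Reasoning
  open Relabel (m∸n≤m n m)
  C-sorted : All (SmallSorted (n ∸ m)) C
  C-sorted = All.map (λ {σ} → InS⇒SmallSorted {σ = σ} (<⇒≤ m<n)) C⊆S
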